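{- For the subset sum problem with positive integer weights $w_1\ge\dots\ge w_n$ and positive integer capacity $C$, if $\tilde\alpha$ is a leaf $0$-tuple and $\tilde\beta$ is a leaf $1$-tuple of its MBnB tree, then $\tilde\alpha\not\le\tilde\beta$ in the componentwise order.
   Context: Let $N=\{1,\dots,n\}$, $W=\sum_{i\in N}w_i$. A map is a pair $(I,\theta)$ with $I\subseteq N$, $\theta:I\to\{0,1\}$. It satisfies the C0-condition if $\sum_{i\in I}\theta(i)w_i>C$, and the C1-condition if $\sum_{i\in I}(1-\theta(i))w_i\ge W-C$. The MBnB tree: the root is $(\emptyset,\emptyset)$; a node satisfying the C0- or C1-condition is a leaf; otherwise (then $I\ne N$) with $i$ the smallest index of $N\setminus I$ the node has two children $(I\cup\{i\},\theta_0)$, $(I\cup\{i\},\theta_1)$ where $\theta_k$ extends $\theta$ by $\theta_k(i)=k$. For a leaf $(I,\theta)$ satisfying the C0-condition, its leaf $0$-tuple is $z\in\{0,1\}^n$ with $z_i=\theta(i)$ for $i\in I$ and $z_i=0$ for $i\notin I$. For a leaf satisfying the C1-condition, its leaf $1$-tuple is $z$ with $z_i=\theta(i)$ for $i\in I$ and $z_i=1$ for $i\notin I$. The order: $\tilde\alpha\le\tilde\beta$ iff $\alpha_i\le\beta_i$ for all $i$. -}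

module Defs where

open import Data.Nat using (ℕ; zero; suc; _+_; _≤_; _<_)
open import Data.Bool using (Bool; true; false)
import Data.Bool as B
open import Data.Maybe using (Maybe; just; nothing)
open import Data.Fin using (Fin; zero; suc)
open import Data.Vec using (Vec; []; _∷_; replicate; lookup; _[_]≔_; zipWith; sum)
open import Data.Product using (_×_)
open import Data.Sum using (_⊎_)
open import Relation.Nullary using (¬_)
open import Relation.Binary.PropositionalEquality using (_≡_)

-- A map (I, θ) is represented as a vector m of length n:
-- i ∈ I  iff  lookup m i = just b, and then θ(i) = b (false = 0, true = 1).
PMap : ℕ → Set
PMap n = Vec (Maybe Bool) n

w1 : ℕ → Maybe Bool → ℕ
w1 w (just true) = w
w1 w _           = 0

w0 : ℕ → Maybe Bool → ℕ
w0 w (just false) = w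
w0 w _            = 0

totalW : ∀ {n} → Vec ℕ n → ℕ
totalW w = sum w

C0 : ∀ {n} → Vec ℕ n → ℕ → PMap n → Set
C0 w C m = C < sum (zipWith w1 w m)

-- C1-condition: Σ_{i∈I} (1-θ(i)) w_i ≥ W - C   (stated over ℤ, i.e. as  S + C ≥ W  in ℕ)
C1 : ∀ {n} → Vec ℕ n → ℕ → PMap n → Set
C1 w C m = totalW w ≤ sum (zipWith w0 w m) + C

firstFree : ∀ {n} → PMap n → Maybe (Fin n)
firstFree []             = nothing
firstFree (nothing ∷ m)  = just zero
firstFree (just _ ∷ m)   with firstFree m
... | just i  = just (suc i)
... | nothing = nothing

data Node {n : ℕ} (w : Vec ℕ n) (C : ℕ) : PMap n → Set where
  root  : Node w C (replicate n nothing)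
  child : ∀ {m : PMap n} {i : Fin n} →
          Node w C m → ¬ C0 w C m → ¬ C1 w C m →
          firstFree m ≡ just i → (k : Bool) →
          Node w C (m [ i ]≔ just k)

fill : Bool → Maybe Bool → Bool
fill d (just b) = b
fill d nothing  = d

tuple0 : ∀ {n} → PMap n → Vec Bool n
tuple0 m = Data.Vec.map (fill false) m

tuple1 : ∀ {n} → PMap n → Vec Bool n
tuple1 m = Data.Vec.map (fill true) m

IsLeaf0Tuple : ∀ {n} → Vec ℕ n → ℕ → Vec Bool n → Set
IsLeaf0Tuple {n} w C α = Data.Product.∃ λ (m : PMap n) → Node w C m × C0 w C m × α ≡ tuple0 m

IsLeaf1Tuple : ∀ {n} → Vec ℕ n → ℕ → Vec Bool n → Set
IsLeaf1Tuple {n} w C β = Data.Product.∃ λ (m : PMap n) → Node w C m × C1 w C m × β ≡ tuple1 m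

_≤ᵥ_ : ∀ {n} → Vec Bool n → Vec Bool n → Set
α ≤ᵥ β = ∀ i → lookup α i B.≤ lookup β i

module Submission where

-- Let (I,θ) be a map satisfying the C0-condition and (J,η) one
-- satisfying the C1-condition.  If their leaf tuples satisfy α ≤ β, then no
-- index i can carry θ(i) = 1 and η(i) = 0 at the same time: that would give
-- α_i = 1 > 0 = β_i.  Hence the indices counted in the C0-sum Σ θ(i) w_i and
-- those counted in the C1-sum Σ (1 - η(i)) w_i are disjoint, and the two sums
-- together are at most W.  But C0 and C1 give
--     W ≤ Σ (1 - η(i)) w_i + C < Σ (1 - η(i)) w_i + Σ θ(i) w_i ≤ W,
-- a contradiction.

open import Defs
open import Data.Nat using (ℕ; _≤_; _<_; _+_; z≤n)
open import Data.Bool using (Bool; true; false)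
import Data.Bool as B
open import Data.Maybe using (Maybe; just; nothing)
open import Data.Fin using (Fin)
import Data.Fin as F
open import Data.Vec using (Vec; lookup; []; _∷_; zipWith; sum)
open import Data.Product using (_,_)
open import Relation.Nullary using (¬_)
open import Relation.Binary.PropositionalEquality using (refl)
open import Data.Nat.Properties
  using (≤-refl; ≤-reflexive; +-identityʳ; +-mono-≤; +-monoʳ-<; +-comm;
         +-commutativeSemigroup; <-irrefl; module ≤-Reasoning)
open import Algebra.Properties.CommutativeSemigroup +-commutativeSemigroup
  using (interchange)

ones : ∀ {n} → Vec ℕ n → PMap n → ℕ
ones w m = sum (zipWith w1 w m)

zeros : ∀ {n} → Vec ℕ n → PMap n → ℕ
zeros w m = sum (zipWith w0 w m)

single-weight-counted-once : (x : ℕ) (a b : Maybe Bool) →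
  fill false a B.≤ fill true b → w1 x a + w0 x b ≤ x
single-weight-counted-once x (just true)  (just true)  _ = ≤-reflexive (+-identityʳ x)
single-weight-counted-once x (just true)  nothing      _ = ≤-reflexive (+-identityʳ x)
single-weight-counted-once x (just true)  (just false) ()
single-weight-counted-once x (just false) (just true)  _ = z≤n
single-weight-counted-once x (just false) (just false) _ = ≤-refl
single-weight-counted-once x (just false) nothing      _ = z≤n
single-weight-counted-once x nothing      (just true)  _ = z≤n
single-weight-counted-once x nothing      (just false) _ = ≤-refl
single-weight-counted-once x nothing      nothing      _ = z≤n

disjoint-sums-bounded : ∀ {n} (w : Vec ℕ n) (m m′ : PMap n) →
  tuple0 m ≤ᵥ tuple1 m′ → ones w m + zeros w m′ ≤ totalW w
disjoint-sums-bounded [] [] [] _ = z≤n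
disjoint-sums-bounded (x ∷ w) (a ∷ m) (b ∷ m′) le = begin
  (w1 x a + ones w m) + (w0 x b + zeros w m′) ≡⟨ interchange (w1 x a) (ones w m) (w0 x b) (zeros w m′) ⟩
  (w1 x a + w0 x b) + (ones w m + zeros w m′) ≤⟨ +-mono-≤ head tail ⟩
  x + totalW w                                ∎
  where
  open ≤-Reasoning
  head : w1 x a + w0 x b ≤ x
  head = single-weight-counted-once x a b (le F.zero)
  tail : ones w m + zeros w m′ ≤ totalW w
  tail = disjoint-sums-bounded w m m′ (λ i → le (F.suc i))

C0-C1-incompatible : ∀ {n} (w : Vec ℕ n) (C : ℕ) (m m′ : PMap n) →
  C0 w C m → C1 w C m′ → ¬ (tuple0 m ≤ᵥ tuple1 m′)
C0-C1-incompatible w C m m′ c0 c1 le = <-irrefl refl (begin-strict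
  totalW w                 ≤⟨ c1 ⟩
  zeros w m′ + C           <⟨ +-monoʳ-< (zeros w m′) c0 ⟩
  zeros w m′ + ones w m    ≡⟨ +-comm (zeros w m′) (ones w m) ⟩
  ones w m + zeros w m′    ≤⟨ disjoint-sums-bounded w m m′ le ⟩
  totalW w                 ∎)
  where open ≤-Reasoning

proposition7 : (n : ℕ) (w : Vec ℕ n) (C : ℕ) →
    (∀ i → 0 < lookup w i) →
    (∀ (i j : Fin n) → i F.≤ j → lookup w j ≤ lookup w i) →
    0 < C →
    (α β : Vec Bool n) →
    IsLeaf0Tuple w C α → IsLeaf1Tuple w C β →
    ¬ (α ≤ᵥ β)
proposition7 n w C _ _ _ α β (m , _ , c0 , refl) (m′ , _ , c1 , refl) =
  C0-C1-incompatible w C m m′ c0 c1
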